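{- Let $n,k,s,t,i$ be positive integers with $t\ge 3$, $(t+1)(k-t+1)\le n$, $t+3\le s\le 2k-t$ and $\max\{t+1,\,s+t-k\}\le i\le \min\{k,\frac{s+t}{2}\}$. Define \[ S_1=s(n-s+1)-i(k-i),\qquad S_2=s(n-s+1)-(s+t-i)(k+i-s-t), \] \[ T_1=i(n-k-s+i+1)+(s-i)(k-i+1),\qquad T_2=(s+t-i)(n-k-i+t+1)+(i-t)(k-s-t+i+1). \] If $(s,i,t)$ is not one of $(8,6,5),(7,5,4),(8,5,3),(8,4,3),(7,5,3),(7,4,3),(6,4,3)$, then \[ S_1+S_2-T_1-T_2\ge s\bigl(k-i+1+k+i-s-t+1\bigr). \] -}

module Defs where

open import Data.Nat using (ℕ)
open import Data.Integer using (ℤ; +_; _+_; _-_; _*_)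
open import Data.Product using (_×_; _,_)
open import Relation.Binary.PropositionalEquality using (_≡_)

S₁ : ℕ → ℕ → ℕ → ℕ → ℕ → ℤ
S₁ n k s t i = + s * (+ n - + s + + 1) - + i * (+ k - + i)

S₂ : ℕ → ℕ → ℕ → ℕ → ℕ → ℤ
S₂ n k s t i = + s * (+ n - + s + + 1) - (+ s + + t - + i) * (+ k + + i - + s - + t)

T₁ : ℕ → ℕ → ℕ → ℕ → ℕ → ℤ
T₁ n k s t i = + i * (+ n - + k - + s + + i + + 1) + (+ s - + i) * (+ k - + i + + 1)

T₂ : ℕ → ℕ → ℕ → ℕ → ℕ → ℤ
T₂ n k s t i = (+ s + + t - + i) * (+ n - + k - + i + + t + + 1)
             + (+ i - + t) * (+ k - + s - + t + + i + + 1)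

data Exceptional : ℕ × ℕ × ℕ → Set where
  e₁ : Exceptional (8 , 6 , 5)
  e₂ : Exceptional (7 , 5 , 4)
  e₃ : Exceptional (8 , 5 , 3)
  e₄ : Exceptional (8 , 4 , 3)
  e₅ : Exceptional (7 , 5 , 3)
  e₆ : Exceptional (7 , 4 , 3)
  e₇ : Exceptional (6 , 4 , 3)

-- Subtracting the right-hand side from S₁ + S₂ − T₁ − T₂ leaves the polynomial
--   (s − t)(n − n₀) + (X − 4)(k − t) + 4(d + c) + (t − 3)(s − t − 2) + 2c(d + c + 2),
-- where n₀ = (t + 1)(k − t + 1), X = (t − 2)(s − t − 2), c = i − t − 1 and d = s + t − 2i.
-- Every factor is nonnegative under the hypotheses except possibly X − 4; X < 4 only for
-- (s, t) ∈ {(6,3), (7,3), (8,3), (7,4), (8,5)}, and there t + 1 ≤ i ≤ (s + t)/2 leaves exactly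
-- the seven exceptional triples.
module Submission where

open import Defs
open import Data.Nat using (ℕ; _≤_; _+_; _*_; _∸_; _⊔_; suc; z≤n; s≤s)
open import Data.Integer using (+_) renaming (_+_ to _+ℤ_; _-_ to _-ℤ_; _*_ to _*ℤ_; _≤_ to _≤ℤ_)
open import Data.Product using (_,_)
open import Relation.Nullary using (¬_; contradiction)

open import Data.Integer using (ℤ; 0ℤ; +≤+)
open import Data.Integer.Properties
  using (pos-*; m-n≡m⊖n; ⊖-≥; i≤j⇒0≤j-i; 0≤i-j⇒j≤i)
  renaming (+-mono-≤ to +ℤ-mono-≤)
open import Data.Nat.Properties
  using (≤-trans; m≤m+n; n≤1+n; +-monoʳ-≤; m⊔n≤o⇒m≤o; m≤m*n; m≤n*m; *-mono-≤; +-cancelˡ-≤;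
         m≤n⇒∃[o]m+o≡n)
import Data.Nat.Tactic.RingSolver as ℕ-Ring
import Data.Integer.Tactic.RingSolver as ℤ-Ring
open import Relation.Binary.PropositionalEquality using (_≡_; refl; sym; trans; cong; subst; subst₂)
open import Function using (_∘_)

0≤i⇒0≤j⇒0≤i*j : ∀ {i j} → 0ℤ ≤ℤ i → 0ℤ ≤ℤ j → 0ℤ ≤ℤ i *ℤ j
0≤i⇒0≤j⇒0≤i*j {+ m} {+ n} _ _ = subst (0ℤ ≤ℤ_) (pos-* m n) (+≤+ z≤n)

n≤m⇒0≤m-n : ∀ {m n} → n ≤ m → 0ℤ ≤ℤ + m -ℤ + n
n≤m⇒0≤m-n n≤m = i≤j⇒0≤j-i (+≤+ n≤m)

n≤m⇒+m-+n≡+[m∸n] : ∀ {m n} → n ≤ m → + m -ℤ + n ≡ + (m ∸ n)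
n≤m⇒+m-+n≡+[m∸n] {m} {n} n≤m = trans (m-n≡m⊖n m n) (⊖-≥ n≤m)

4≤[1+a]*[1+b] : ∀ a b c → c * 2 ≤ suc b →
  ¬ Exceptional (3 + a + 3 + b , 3 + a + 1 + c , 3 + a) → 4 ≤ suc a * suc b
4≤[1+a]*[1+b] (suc (suc (suc a))) b c _ _ = ≤-trans (m≤m+n 4 a) (m≤m*n (4 + a) (suc b))
4≤[1+a]*[1+b] a (suc (suc (suc b))) c _ _ = ≤-trans (m≤m+n 4 b) (m≤n*m (4 + b) (suc a))
4≤[1+a]*[1+b] (suc a) (suc b) c _ _ =
  *-mono-≤ {2} {suc (suc a)} {2} {suc (suc b)} (s≤s (s≤s z≤n)) (s≤s (s≤s z≤n))
4≤[1+a]*[1+b] 0 0 0 _ ¬exc = contradiction e₇ ¬exc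
4≤[1+a]*[1+b] 0 0 (suc c) (s≤s ()) _
4≤[1+a]*[1+b] 0 1 0 _ ¬exc = contradiction e₆ ¬exc
4≤[1+a]*[1+b] 0 1 1 _ ¬exc = contradiction e₅ ¬exc
4≤[1+a]*[1+b] 0 1 (suc (suc c)) (s≤s (s≤s ())) _
4≤[1+a]*[1+b] 0 2 0 _ ¬exc = contradiction e₄ ¬exc
4≤[1+a]*[1+b] 0 2 1 _ ¬exc = contradiction e₃ ¬exc
4≤[1+a]*[1+b] 0 2 (suc (suc c)) (s≤s (s≤s (s≤s ()))) _
4≤[1+a]*[1+b] 1 0 0 _ ¬exc = contradiction e₂ ¬exc
4≤[1+a]*[1+b] 1 0 (suc c) (s≤s ()) _
4≤[1+a]*[1+b] 2 0 0 _ ¬exc = contradiction e₁ ¬exc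
4≤[1+a]*[1+b] 2 0 (suc c) (s≤s ()) _

4≤[t-2]*[s-[t+2]] : ∀ {s t i} → 3 ≤ t → t + 3 ≤ s → t + 1 ≤ i → 2 * i ≤ s + t →
  ¬ Exceptional (s , i , t) → + 4 ≤ℤ (+ t -ℤ + 2) *ℤ (+ s -ℤ (+ t +ℤ + 2))
4≤[t-2]*[s-[t+2]] 3≤t t+3≤s t+1≤i 2i≤s+t ¬exc
  with m≤n⇒∃[o]m+o≡n 3≤t | m≤n⇒∃[o]m+o≡n t+3≤s | m≤n⇒∃[o]m+o≡n t+1≤i
... | a , refl | b , refl | c , refl =
  subst (+ 4 ≤ℤ_) (trans (pos-* (suc a) (suc b)) (slack-product (+ a) (+ b)))
    (+≤+ (4≤[1+a]*[1+b] a b c (2i≤s+t⇒c*2≤1+b (3 + a) b c 2i≤s+t) ¬exc))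
  where
  slack-product : ∀ A B → (+ 1 +ℤ A) *ℤ (+ 1 +ℤ B)
    ≡ ((+ 3 +ℤ A) -ℤ + 2) *ℤ ((+ 3 +ℤ A +ℤ + 3 +ℤ B) -ℤ ((+ 3 +ℤ A) +ℤ + 2))
  slack-product = ℤ-Ring.solve-∀
  2i≤s+t⇒c*2≤1+b : ∀ t b c → 2 * (t + 1 + c) ≤ t + 3 + b + t → c * 2 ≤ suc b
  2i≤s+t⇒c*2≤1+b t b c = +-cancelˡ-≤ (t * 2 + 2) _ _ ∘ subst₂ _≤_ (lhs t c) (rhs t b)
    where
    lhs : ∀ t c → 2 * (t + 1 + c) ≡ t * 2 + 2 + c * 2
    lhs = ℕ-Ring.solve-∀
    rhs : ∀ t b → t + 3 + b + t ≡ t * 2 + 2 + suc b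
    rhs = ℕ-Ring.solve-∀

excess-decomposition : ∀ N K S T I →
  ((S *ℤ (N -ℤ S +ℤ + 1) -ℤ I *ℤ (K -ℤ I))
    +ℤ (S *ℤ (N -ℤ S +ℤ + 1) -ℤ (S +ℤ T -ℤ I) *ℤ (K +ℤ I -ℤ S -ℤ T)))
  -ℤ ((I *ℤ (N -ℤ K -ℤ S +ℤ I +ℤ + 1) +ℤ (S -ℤ I) *ℤ (K -ℤ I +ℤ + 1))
    +ℤ ((S +ℤ T -ℤ I) *ℤ (N -ℤ K -ℤ I +ℤ T +ℤ + 1) +ℤ (I -ℤ T) *ℤ (K -ℤ S -ℤ T +ℤ I +ℤ + 1)))
  -ℤ S *ℤ ((K -ℤ I +ℤ + 1) +ℤ (K +ℤ I -ℤ S -ℤ T +ℤ + 1))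
  ≡ (S -ℤ T) *ℤ (N -ℤ (T +ℤ + 1) *ℤ (K -ℤ T +ℤ + 1))
    +ℤ ((T -ℤ + 2) *ℤ (S -ℤ (T +ℤ + 2)) -ℤ + 4) *ℤ (K -ℤ T)
    +ℤ + 4 *ℤ ((S +ℤ T -ℤ + 2 *ℤ I) +ℤ (I -ℤ (T +ℤ + 1)))
    +ℤ (T -ℤ + 3) *ℤ (S -ℤ (T +ℤ + 2))
    +ℤ + 2 *ℤ (I -ℤ (T +ℤ + 1)) *ℤ ((S +ℤ T -ℤ + 2 *ℤ I) +ℤ (I -ℤ (T +ℤ + 1)) +ℤ + 2)
excess-decomposition = ℤ-Ring.solve-∀

decomposition-nonNeg : ∀ {p q x y d c u v} →
  0ℤ ≤ℤ p → 0ℤ ≤ℤ q → + 4 ≤ℤ x → 0ℤ ≤ℤ y → 0ℤ ≤ℤ d → 0ℤ ≤ℤ c → 0ℤ ≤ℤ u → 0ℤ ≤ℤ v →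
  0ℤ ≤ℤ p *ℤ q +ℤ (x -ℤ + 4) *ℤ y +ℤ + 4 *ℤ (d +ℤ c) +ℤ u *ℤ v +ℤ + 2 *ℤ c *ℤ (d +ℤ c +ℤ + 2)
decomposition-nonNeg 0≤p 0≤q 4≤x 0≤y 0≤d 0≤c 0≤u 0≤v =
  0≤p 0* 0≤q 0+ i≤j⇒0≤j-i 4≤x 0* 0≤y 0+ +≤+ (z≤n {4}) 0* (0≤d 0+ 0≤c) 0+ 0≤u 0* 0≤v
  0+ +≤+ (z≤n {2}) 0* 0≤c 0* (0≤d 0+ 0≤c 0+ +≤+ (z≤n {2}))
  where
  infixl 6 _0+_
  infixl 7 _0*_
  _0+_ : ∀ {i j} → 0ℤ ≤ℤ i → 0ℤ ≤ℤ j → 0ℤ ≤ℤ i +ℤ j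
  _0+_ = +ℤ-mono-≤
  _0*_ : ∀ {i j} → 0ℤ ≤ℤ i → 0ℤ ≤ℤ j → 0ℤ ≤ℤ i *ℤ j
  _0*_ = 0≤i⇒0≤j⇒0≤i*j

lemma3p3 : (n k s t i : ℕ) → 1 ≤ n → 1 ≤ k → 1 ≤ s → 1 ≤ t → 1 ≤ i →
    3 ≤ t → (t + 1) * ((k ∸ t) + 1) ≤ n → t + 3 ≤ s → s + t ≤ 2 * k →
    (t + 1) ⊔ ((s + t) ∸ k) ≤ i → i ≤ k → 2 * i ≤ s + t →
    ¬ Exceptional (s , i , t) →
    + s *ℤ ((+ k -ℤ + i +ℤ + 1) +ℤ (+ k +ℤ + i -ℤ + s -ℤ + t +ℤ + 1))
    ≤ℤ (S₁ n k s t i +ℤ S₂ n k s t i) -ℤ (T₁ n k s t i +ℤ T₂ n k s t i)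
lemma3p3 n k s t i _ _ _ _ _ 3≤t n₀≤n t+3≤s _ t+1⊔[s+t∸k]≤i i≤k 2i≤s+t ¬exc =
  0≤i-j⇒j≤i (subst (0ℤ ≤ℤ_) (sym (excess-decomposition (+ n) (+ k) (+ s) (+ t) (+ i)))
    (decomposition-nonNeg (n≤m⇒0≤m-n t≤s) 0≤n-n₀
      (4≤[t-2]*[s-[t+2]] 3≤t t+3≤s t+1≤i 2i≤s+t ¬exc) (n≤m⇒0≤m-n t≤k)
      0≤s+t-2i (n≤m⇒0≤m-n t+1≤i) (n≤m⇒0≤m-n 3≤t) (n≤m⇒0≤m-n t+2≤s)))
  where
  t+1≤i : t + 1 ≤ i
  t+1≤i = m⊔n≤o⇒m≤o (t + 1) _ t+1⊔[s+t∸k]≤i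
  t≤k : t ≤ k
  t≤k = ≤-trans (m≤m+n t 1) (≤-trans t+1≤i i≤k)
  t+2≤s : t + 2 ≤ s
  t+2≤s = ≤-trans (+-monoʳ-≤ t (n≤1+n 2)) t+3≤s
  t≤s : t ≤ s
  t≤s = ≤-trans (m≤m+n t 2) t+2≤s
  0≤n-n₀ : 0ℤ ≤ℤ + n -ℤ (+ t +ℤ + 1) *ℤ (+ k -ℤ + t +ℤ + 1)
  0≤n-n₀ = subst (λ n₀ → 0ℤ ≤ℤ + n -ℤ n₀)
    (trans (pos-* (t + 1) (k ∸ t + 1)) (cong (λ d → + (t + 1) *ℤ (d +ℤ + 1)) (sym (n≤m⇒+m-+n≡+[m∸n] t≤k))))
    (n≤m⇒0≤m-n n₀≤n)
  0≤s+t-2i : 0ℤ ≤ℤ + s +ℤ + t -ℤ + 2 *ℤ + i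
  0≤s+t-2i = subst (λ j → 0ℤ ≤ℤ + (s + t) -ℤ j) (pos-* 2 i) (n≤m⇒0≤m-n 2i≤s+t)
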